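{- Let $\Gamma_\Phi$ be the CSTN constructed from a Q3SAT formula $\Phi$, and let $\sigma$ be a viable and dynamic execution strategy for $\Gamma_\Phi$. Let $s$ be any scenario and $i\in\{1,\dots,n\}$, and suppose $[\sigma(s)]_{B_i}-[\sigma(s)]_{A_i}\le i-1$. Let $h=0$ if $[\sigma(s)]_{C_i^0}<[\sigma(s)]_{B_i}+1$ and $h=1$ otherwise. Then for $s'=s[h/x_i]$ we have $[\sigma(s')]_{B_{i+1}}-[\sigma(s')]_{A_{i+1}}\le i$.
   Context: CSTN notions: a label over a finite set $\mathcal P$ of propositional variables is a conjunction of literals on distinct variables; the empty label $\lambda$ is always true. A scenario is $s:\mathcal P\to\{0,1\}$; $s\vDash\ell$ means $\ell$ true under $s$; $s[v/p]$ is $s$ with the value of $p$ changed to $v$. A CSTN is $\Gamma=(\mathcal T,\mathcal P,\mathcal C,\mathcal L,\mathcal{OT},\mathcal O)$ with $\mathcal T$ a finite set of tasks, $\mathcal C$ a finite set of labeled constraints $(Y-X\le\delta,\ell)$, $\mathcal L$ a label on each task, $\mathcal{OT}\subseteq\mathcal T$, $\mathcal O:\mathcal P\to\mathcal{OT}$ a bijection. For a scenario $s$, $\mathcal T_s=\{X:s\vDash\mathcal L(X)\}$ and $\mathcal C_s$ is the set of constraints $Y-X\le\delta$ whose label holds in $s$. An execution strategy $\sigma$ maps each scenario $s$ to $\sigma(s):\mathcal T_s\to\mathbb R$ (write $[\sigma(s)]_X$); it is viable if each $\sigma(s)$ satisfies all constraints of $\mathcal C_s$. $\mathrm{Hist}(t,s,\sigma)$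 is the restriction of $s$ to $\{p:[\sigma(s)]_{\mathcal O(p)}<t\}$. $\sigma$ is dynamic if for all $s,s'$ and $X\in\mathcal T_s$, with $t=[\sigma(s)]_X$, $\mathrm{Hist}(t,s,\sigma)=\mathrm{Hist}(t,s',\sigma)$ implies $X\in\mathcal T_{s'}$ and $[\sigma(s')]_X=t$. Construction: $\Phi=\exists x_1\forall y_1\cdots\exists x_n\forall y_n\,\varphi$ with $\varphi=\bigwedge_{j=1}^m(l_{j,1}\vee l_{j,2}\vee l_{j,3})$, each literal a positive or negated occurrence of one of $x_1,y_1,\dots,x_n,y_n$. $\Gamma_\Phi$ has tasks $A_i,B_i,C_i^0,C_i^1,D_i,X_i,Y_i$ ($i=1,\dots,n$) and $A_{n+1},B_{n+1}$; propositional variables $x_i,y_i,c_i^0,c_i^1$; all task labels empty; $\mathcal O(x_i)=X_i$, $\mathcal O(y_i)=Y_i$, $\mathcal O(c_i^0)=C_i^0$, $\mathcal O(c_i^1)=C_i^1$; constraints: $(B_1-A_1\le0,\lambda)$; for $i=1,\dots,n$: $(D_i\le B_i+1,\ c_i^0\wedge c_i^1)$, $(D_i\ge A_i+(n+2),\ \neg c_i^0\wedge\neg c_i^1)$, $(X_i\ge A_i+(n+2),\lambda)$, $(Y_i\ge X_i+1,\lambda)$, $(A_{i+1}\ge Y_i+1,\lambda)$, $(B_{i+1}\le C_i^0+(n+4),\ \neg x_i)$, $(B_{i+1}\le C_i^1+(n+4),\ x_i)$; for $j=1,\dots,m$: $(B_{n+1}-A_{n+1}\ge n+1,\ \neg l_{j,1}\wedge\neg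 l_{j,2}\wedge\neg l_{j,3})$. -}

module Defs where

open import Data.Nat using (ℕ; zero; suc) renaming (_+_ to _+ℕ_)
open import Data.Integer using (ℤ; +_; -[1+_]) renaming (-_ to -ℤ_)
open import Data.Fin using (Fin; zero; suc; inject₁; fromℕ)
open import Data.Fin.Properties using () renaming (_≟_ to _≟F_)
open import Data.Bool using (Bool; true; false; not)
open import Data.List using (List; []; _∷_; _++_; map; concatMap)
open import Data.List.Membership.Propositional using (_∈_)
open import Data.List.Relation.Unary.All using (All)
open import Data.Product using (_×_; _,_)
open import Data.Sum using (_⊎_)
open import Relation.Binary.PropositionalEquality using (_≡_; _≢_)
open import Relation.Nullary using (¬_; yes; no)

-- Time domain: a totally ordered abelian group with a positive unit.
-- (The reals with their usual order and 1 are an instance.)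

record OrderedGroup : Set₁ where
  infixl 6 _+_ _-_
  infix 4 _≤_ _<_
  field
    Carrier  : Set
    _+_      : Carrier → Carrier → Carrier
    0#       : Carrier
    -_       : Carrier → Carrier
    1#       : Carrier
    _≤_      : Carrier → Carrier → Set
    +-assoc    : ∀ x y z → (x + y) + z ≡ x + (y + z)
    +-comm     : ∀ x y → x + y ≡ y + x
    +-identityʳ : ∀ x → x + 0# ≡ x
    -‿inverseʳ : ∀ x → x + (- x) ≡ 0#
    ≤-refl     : ∀ x → x ≤ x
    ≤-trans    : ∀ {x y z} → x ≤ y → y ≤ z → x ≤ z
    ≤-antisym  : ∀ {x y} → x ≤ y → y ≤ x → x ≡ y
    ≤-total    : ∀ x y → (x ≤ y) ⊎ (y ≤ x)
    +-monoˡ-≤  : ∀ {x y} z → x ≤ y → x + z ≤ y + z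
    0<1        : 0# ≤ 1# × 0# ≢ 1#

  _-_ : Carrier → Carrier → Carrier
  x - y = x + (- y)

  _<_ : Carrier → Carrier → Set
  x < y = x ≤ y × x ≢ y

  fromℕ' : ℕ → Carrier
  fromℕ' zero    = 0#
  fromℕ' (suc k) = fromℕ' k + 1#

  ι : ℤ → Carrier
  ι (+ k)      = fromℕ' k
  ι -[1+ k ]   = - (fromℕ' k + 1#)

-- Q3SAT formulas  ∃x₁∀y₁…∃xₙ∀yₙ φ ; index i : Fin n stands for i+1.

data QVar (n : ℕ) : Set where
  xv yv : Fin n → QVar n

-- a literal: variable with polarity (true = positive occurrence)
QLit : ℕ → Set
QLit n = QVar n × Bool

Clause : ℕ → Set
Clause n = QLit n × QLit n × QLit n

CNF : ℕ → Set
CNF n = List (Clause n)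

-- tasks; A and B are indexed by Fin (suc n) (A_{n+1}, B_{n+1} = fromℕ n)
data Task (n : ℕ) : Set where
  A B : Fin (suc n) → Task n
  C0 C1 D X Y : Fin n → Task n

data Prop (n : ℕ) : Set where
  px py pc0 pc1 : Fin n → Prop n

O : ∀ {n} → Prop n → Task n
O (px i)  = X i
O (py i)  = Y i
O (pc0 i) = C0 i
O (pc1 i) = C1 i

-- labels: conjunctions of literals (variable, truth value required)
Label : ℕ → Set
Label n = List (Prop n × Bool)

λ₀ : ∀ {n} → Label n
λ₀ = []

Scenario : ℕ → Set
Scenario n = Prop n → Bool

_⊨_ : ∀ {n} → Scenario n → Label n → Set
s ⊨ ℓ = All (λ { (p , b) → s p ≡ b }) ℓ

_[_/_] : ∀ {n} → Scenario n → Bool → Prop n → Scenario n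
(s [ v / px i ]) (px j) with i ≟F j
... | yes _ = v
... | no _  = s (px j)
(s [ v / py i ]) (py j) with i ≟F j
... | yes _ = v
... | no _  = s (py j)
(s [ v / pc0 i ]) (pc0 j) with i ≟F j
... | yes _ = v
... | no _  = s (pc0 j)
(s [ v / pc1 i ]) (pc1 j) with i ≟F j
... | yes _ = v
... | no _  = s (pc1 j)
(s [ v / _ ]) q = s q

record Constraint (n : ℕ) : Set where
  constructor ⟨_-_≤_,_⟩
  field
    to    : Task n
    from  : Task n
    δ     : ℤ
    label : Label n

qprop : ∀ {n} → QVar n → Prop n
qprop (xv i) = px i
qprop (yv i) = py i

negLit : ∀ {n} → QLit n → Prop n × Bool
negLit (v , pol) = (qprop v , not pol)

perIndex : (n : ℕ) → Fin n → List (Constraint n)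
perIndex n i =
    ⟨ D i - B (inject₁ i) ≤ + 1 , (pc0 i , true) ∷ (pc1 i , true) ∷ [] ⟩
  ∷ ⟨ A (inject₁ i) - D i ≤ -ℤ (+ (n +ℕ 2)) , (pc0 i , false) ∷ (pc1 i , false) ∷ [] ⟩
  ∷ ⟨ A (inject₁ i) - X i ≤ -ℤ (+ (n +ℕ 2)) , λ₀ ⟩
  ∷ ⟨ X i - Y i ≤ -ℤ (+ 1) , λ₀ ⟩
  ∷ ⟨ Y i - A (suc i) ≤ -ℤ (+ 1) , λ₀ ⟩
  ∷ ⟨ B (suc i) - C0 i ≤ + (n +ℕ 4) , (px i , false) ∷ [] ⟩
  ∷ ⟨ B (suc i) - C1 i ≤ + (n +ℕ 4) , (px i , true) ∷ [] ⟩
  ∷ []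

perClause : (n : ℕ) → Clause n → Constraint n
perClause n (l₁ , l₂ , l₃) =
  ⟨ A (fromℕ n) - B (fromℕ n) ≤ -ℤ (+ (n +ℕ 1)) , negLit l₁ ∷ negLit l₂ ∷ negLit l₃ ∷ [] ⟩

allFinL : (n : ℕ) → List (Fin n)
allFinL zero    = []
allFinL (suc n) = zero ∷ map suc (allFinL n)

-- the constraint set 𝒞 of Γ_Φ (all task labels are empty, so 𝒯_s = 𝒯)
constraints : (n : ℕ) → CNF n → List (Constraint n)
constraints n φ =
    ⟨ B zero - A zero ≤ + 0 , λ₀ ⟩
  ∷ (concatMap (perIndex n) (allFinL n) ++ map (perClause n) φ)

module Strategies (G : OrderedGroup) where
  open OrderedGroup G

  -- σ(s) : 𝒯_s → time, and 𝒯_s = 𝒯 since every task label is λ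
  Strategy : ℕ → Set
  Strategy n = Scenario n → Task n → Carrier

  Viable : ∀ {n} → CNF n → Strategy n → Set
  Viable {n} φ σ = ∀ (s : Scenario n) (c : Constraint n) → c ∈ constraints n φ →
    s ⊨ Constraint.label c →
    σ s (Constraint.to c) - σ s (Constraint.from c) ≤ ι (Constraint.δ c)

  -- Hist(t,s,σ) = Hist(t,s',σ): same domain {p : [σ(.)]_{O p} < t}
  -- and same values on it
  HistEq : ∀ {n} → Strategy n → Carrier → Scenario n → Scenario n → Set
  HistEq σ t s s' = ∀ p →
      ((σ s (O p) < t → σ s' (O p) < t) × (σ s' (O p) < t → σ s (O p) < t))
    × (σ s (O p) < t → s p ≡ s' p)

  Dynamic : ∀ {n} → Strategy n → Set
  Dynamic {n} σ = ∀ (s s' : Scenario n) (T : Task n) →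
    HistEq σ (σ s T) s s' → σ s' T ≡ σ s T

-- Let a and b be the times of A_i and B_i in s, so that b + 1 ≤ a + i < a + n + 2.
-- If both c_i^0 and c_i^1 were observed at or after b + 1, the scenarios s, s[1/c_i^0,1/c_i^1]
-- and s[0/c_i^0,0/c_i^1] would share their history up to b + 1, hence (the strategy being
-- dynamic) execute B_i at b, D_i at the same time in both modified scenarios, and A_i at a.
-- The first modified scenario forces D_i ≤ b + 1, the second D_i ≥ a + n + 2: impossible.
-- So c_i^h is observed by b + 1 ≤ a + i. Flipping x_i, observed at X_i ≥ a + n + 2, does not
-- move A_i or C_i^h, and the constraint B_{i+1} ≤ C_i^h + n + 4 guarded by x_i = h, together
-- with A_{i+1} ≥ X_i + 2 ≥ a + n + 4, gives B_{i+1} - A_{i+1} ≤ i.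
module Submission where

open import Defs
open import Data.Nat using (ℕ; zero; suc; z≤n; s≤s) renaming (_+_ to _+ℕ_; _<_ to _<ℕ_)
import Data.Nat.Properties as ℕ
open import Data.Integer using (+_) renaming (-_ to -ℤ_)
open import Data.Fin using (Fin; toℕ; inject₁; suc; zero)
open import Data.Fin.Induction using (spo-wellFounded)
open import Data.Fin.Properties using (toℕ<n) renaming (_≟_ to _≟F_)
open import Data.Bool using (Bool; true; false)
open import Data.Product using (_×_; _,_; proj₁)
open import Data.Sum using (_⊎_; inj₁; inj₂; [_,_]′)
open import Data.List using (List; []; _∷_; map; concat; cartesianProduct; lookup; length)
open import Data.List.Relation.Unary.Any using (here; there; index)
open import Data.List.Relation.Unary.Any.Properties using (lookup-index)
open import Data.List.Relation.Unary.All using ([]; _∷_)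
open import Data.List.Membership.Propositional using (_∈_; lose)
open import Data.List.Membership.Propositional.Properties
  using (∈-map⁺; ∈-++⁺ˡ; ∈-concat⁺′; ∈-concatMap⁺; ∈-cartesianProduct⁺)
open import Induction.WellFounded using (WellFounded; module Subrelation; module All)
open import Relation.Binary using (Rel; Irreflexive; Transitive; IsStrictPartialOrder; TotalOrder)
import Relation.Binary.Construct.On as On
import Relation.Binary.Properties.TotalOrder as TotalOrderProperties
import Relation.Binary.Reasoning.PartialOrder as PartialOrderReasoning
open import Relation.Binary.PropositionalEquality
  using (_≡_; _≢_; refl; sym; trans; cong; subst; subst₂; isEquivalence; ≡-≟-identity; ≢-≟-identity;
         module ≡-Reasoning)
open import Relation.Nullary using (¬_)

finite-spo-wellFounded : ∀ {a ℓ} {A : Set a} {_⊏_ : Rel A ℓ} (xs : List A) → (∀ x → x ∈ xs) →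
                         Irreflexive _≡_ _⊏_ → Transitive _⊏_ → WellFounded _⊏_
finite-spo-wellFounded {_⊏_ = _⊏_} xs complete irrefl ⊏-trans =
  Subrelation.wellFounded position-mono (On.wellFounded position (spo-wellFounded isSPO))
  where
  _⊏ᶠ_ : Rel (Fin (length xs)) _
  i ⊏ᶠ j = lookup xs i ⊏ lookup xs j

  isSPO : IsStrictPartialOrder _≡_ _⊏ᶠ_
  isSPO = record
    { isEquivalence = isEquivalence
    ; irrefl        = λ { refl → irrefl refl }
    ; trans         = ⊏-trans
    ; <-resp-≈      = (λ { refl r → r }) , (λ { refl r → r })
    }

  position : _ → Fin (length xs)
  position x = index (complete x)

  position-mono : ∀ {x y} → x ⊏ y → position x ⊏ᶠ position y
  position-mono {x} {y} = subst₂ _⊏_ (lookup-index (complete x)) (lookup-index (complete y))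

update-same : ∀ {n} (s : Scenario n) v p → (s [ v / p ]) p ≡ v
update-same s v (px i)  rewrite ≡-≟-identity _≟F_ {i} refl = refl
update-same s v (py i)  rewrite ≡-≟-identity _≟F_ {i} refl = refl
update-same s v (pc0 i) rewrite ≡-≟-identity _≟F_ {i} refl = refl
update-same s v (pc1 i) rewrite ≡-≟-identity _≟F_ {i} refl = refl

update-≢ : ∀ {n} (s : Scenario n) v {p q} → p ≢ q → (s [ v / q ]) p ≡ s p
update-≢ s v {px j}  {px i}  p≢q rewrite ≢-≟-identity _≟F_ {i} {j} λ { refl → p≢q refl } = refl
update-≢ s v {py j}  {py i}  p≢q rewrite ≢-≟-identity _≟F_ {i} {j} λ { refl → p≢q refl } = refl
update-≢ s v {pc0 j} {pc0 i} p≢q rewrite ≢-≟-identity _≟F_ {i} {j} λ { refl → p≢q refl } = refl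
update-≢ s v {pc1 j} {pc1 i} p≢q rewrite ≢-≟-identity _≟F_ {i} {j} λ { refl → p≢q refl } = refl
update-≢ s v {py _} {px _} _ = refl
update-≢ s v {pc0 _} {px _} _ = refl
update-≢ s v {pc1 _} {px _} _ = refl
update-≢ s v {px _} {py _} _ = refl
update-≢ s v {pc0 _} {py _} _ = refl
update-≢ s v {pc1 _} {py _} _ = refl
update-≢ s v {px _} {pc0 _} _ = refl
update-≢ s v {py _} {pc0 _} _ = refl
update-≢ s v {pc1 _} {pc0 _} _ = refl
update-≢ s v {px _} {pc1 _} _ = refl
update-≢ s v {py _} {pc1 _} _ = refl
update-≢ s v {pc0 _} {pc1 _} _ = refl

allFinL-complete : ∀ {n} (i : Fin n) → i ∈ allFinL n
allFinL-complete zero    = here refl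
allFinL-complete (suc i) = there (∈-map⁺ suc (allFinL-complete i))

perIndex⊆constraints : ∀ {n} (φ : CNF n) (i : Fin n) {c} → c ∈ perIndex n i → c ∈ constraints n φ
perIndex⊆constraints {n} φ i c∈ =
  there (∈-++⁺ˡ (∈-concatMap⁺ (perIndex n) (lose (allFinL-complete i) c∈)))

taskKinds : (n : ℕ) → List (List (Task n))
taskKinds n =
  map A (allFinL (suc n)) ∷ map B (allFinL (suc n)) ∷ map C0 (allFinL n) ∷ map C1 (allFinL n)
  ∷ map D (allFinL n) ∷ map X (allFinL n) ∷ map Y (allFinL n) ∷ []

allTasks : (n : ℕ) → List (Task n)
allTasks n = concat (taskKinds n)

allTasks-complete : ∀ {n} (T : Task n) → T ∈ allTasks n
allTasks-complete (A i) =
  ∈-concat⁺′ {xss = taskKinds _} (∈-map⁺ A (allFinL-complete i)) (here refl)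
allTasks-complete (B i) =
  ∈-concat⁺′ {xss = taskKinds _} (∈-map⁺ B (allFinL-complete i)) (there (here refl))
allTasks-complete (C0 i) =
  ∈-concat⁺′ {xss = taskKinds _} (∈-map⁺ C0 (allFinL-complete i)) (there (there (here refl)))
allTasks-complete (C1 i) =
  ∈-concat⁺′ {xss = taskKinds _} (∈-map⁺ C1 (allFinL-complete i)) (there (there (there (here refl))))
allTasks-complete (D i) =
  ∈-concat⁺′ {xss = taskKinds _} (∈-map⁺ D (allFinL-complete i)) (there (there (there (there (here refl)))))
allTasks-complete (X i) =
  ∈-concat⁺′ {xss = taskKinds _} (∈-map⁺ X (allFinL-complete i)) (there (there (there (there (there (here refl))))))
allTasks-complete (Y i) =
  ∈-concat⁺′ {xss = taskKinds _} (∈-map⁺ Y (allFinL-complete i)) (there (there (there (there (there (there (here refl)))))))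

bool-complete : (b : Bool) → b ∈ true ∷ false ∷ []
bool-complete true  = here refl
bool-complete false = there (here refl)

module OrderedGroupProperties (G : OrderedGroup) where
  open OrderedGroup G

  totalOrder : TotalOrder _ _ _
  totalOrder = record
    { isTotalOrder = record
      { isPartialOrder = record
        { isPreorder = record
          { isEquivalence = isEquivalence
          ; reflexive     = λ { refl → ≤-refl _ }
          ; trans         = ≤-trans
          }
        ; antisym = ≤-antisym
        }
      ; total = ≤-total
      }
    }

  open TotalOrderProperties totalOrder public using (<-irrefl; <-trans; <⇒≱; ≰⇒>; ≰⇒≥)
  module ≤-Reasoning = PartialOrderReasoning (TotalOrder.poset totalOrder)

  <-≤-trans : ∀ {x y z} → x < y → y ≤ z → x < z
  <-≤-trans {x} {y} {z} x<y y≤z = begin-strict x <⟨ x<y ⟩ y ≤⟨ y≤z ⟩ z ∎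
    where open ≤-Reasoning

  ≤-<-trans : ∀ {x y z} → x ≤ y → y < z → x < z
  ≤-<-trans {x} {y} {z} x≤y y<z = begin-strict x ≤⟨ x≤y ⟩ y <⟨ y<z ⟩ z ∎
    where open ≤-Reasoning

  x-y+y≡x : ∀ x y → (x - y) + y ≡ x
  x-y+y≡x x y = begin
    (x + - y) + y  ≡⟨ +-assoc x (- y) y ⟩
    x + (- y + y)  ≡⟨ cong (λ w → x + w) (+-comm (- y) y) ⟩
    x + (y + - y)  ≡⟨ cong (λ w → x + w) (-‿inverseʳ y) ⟩
    x + 0#         ≡⟨ +-identityʳ x ⟩
    x              ∎
    where open ≡-Reasoning

  x+y-y≡x : ∀ x y → (x + y) - y ≡ x
  x+y-y≡x x y = trans (+-assoc x y (- y)) (trans (cong (λ w → x + w) (-‿inverseʳ y)) (+-identityʳ x))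

  +-swapʳ : ∀ x y z → (x + y) + z ≡ (x + z) + y
  +-swapʳ x y z = trans (+-assoc x y z) (trans (cong (λ w → x + w) (+-comm y z)) (sym (+-assoc x z y)))

  +-monoʳ-≤ : ∀ {x y} z → x ≤ y → z + x ≤ z + y
  +-monoʳ-≤ {x} {y} z x≤y = subst₂ _≤_ (+-comm x z) (+-comm y z) (+-monoˡ-≤ z x≤y)

  +-cancelˡ-≡ : ∀ z {x y} → z + x ≡ z + y → x ≡ y
  +-cancelˡ-≡ z {x} {y} eq = begin
    x              ≡⟨ sym (x+y-y≡x x z) ⟩
    (x + z) - z    ≡⟨ cong (_- z) (+-comm x z) ⟩
    (z + x) - z    ≡⟨ cong (_- z) eq ⟩
    (z + y) - z    ≡⟨ cong (_- z) (+-comm z y) ⟩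
    (y + z) - z    ≡⟨ x+y-y≡x y z ⟩
    y              ∎
    where open ≡-Reasoning

  +-monoʳ-< : ∀ {x y} z → x < y → z + x < z + y
  +-monoʳ-< z (x≤y , x≢y) = +-monoʳ-≤ z x≤y , λ eq → x≢y (+-cancelˡ-≡ z eq)

  -≤⇒≤+ : ∀ {x y d} → x - y ≤ d → x ≤ y + d
  -≤⇒≤+ {x} {y} {d} x-y≤d = subst₂ _≤_ (x-y+y≡x x y) (+-comm d y) (+-monoˡ-≤ y x-y≤d)

  ≤+⇒-≤ : ∀ {x y d} → x ≤ y + d → x - y ≤ d
  ≤+⇒-≤ {x} {y} {d} x≤y+d =
    subst (x - y ≤_) (trans (cong (_- y) (+-comm y d)) (x+y-y≡x d y)) (+-monoˡ-≤ (- y) x≤y+d)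

  x<x+1 : ∀ x → x < x + 1#
  x<x+1 x = subst (_< x + 1#) (+-identityʳ x) (+-monoʳ-< x 0<1)

  fromℕ'-1 : fromℕ' 1 ≡ 1#
  fromℕ'-1 = trans (+-comm 0# 1#) (+-identityʳ 1#)

  fromℕ'-+ : ∀ m m' → fromℕ' (m' +ℕ m) ≡ fromℕ' m + fromℕ' m'
  fromℕ'-+ m zero     = sym (+-identityʳ (fromℕ' m))
  fromℕ'-+ m (suc m') = trans (cong (_+ 1#) (fromℕ'-+ m m')) (+-assoc (fromℕ' m) (fromℕ' m') 1#)

  fromℕ'-strictMono : ∀ {m m'} → m <ℕ m' → fromℕ' m < fromℕ' m'
  fromℕ'-strictMono {m} {suc m'} m<1+m' with ℕ.m<1+n⇒m<n∨m≡n m<1+m'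
  ... | inj₁ m<m' = <-trans (fromℕ'-strictMono m<m') (x<x+1 (fromℕ' m'))
  ... | inj₂ refl = x<x+1 (fromℕ' m)

  x<x+fromℕ' : ∀ x {m} → 0 <ℕ m → x < x + fromℕ' m
  x<x+fromℕ' x {m} 0<m =
    subst (_< x + fromℕ' m) (+-identityʳ x) (+-monoʳ-< x (fromℕ'-strictMono 0<m))

  -0#≡0# : - 0# ≡ 0#
  -0#≡0# = trans (sym (trans (+-comm 0# (- 0#)) (+-identityʳ (- 0#)))) (-‿inverseʳ 0#)

  ι-neg : ∀ m → ι (-ℤ (+ m)) ≡ - fromℕ' m
  ι-neg zero    = sym -0#≡0#
  ι-neg (suc m) = refl

  -≤ι-neg⇒+≤ : ∀ {x y} m → x - y ≤ ι (-ℤ (+ m)) → x + fromℕ' m ≤ y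
  -≤ι-neg⇒+≤ {x} {y} m x-y≤-m =
    subst (x + fromℕ' m ≤_) (x-y+y≡x y (fromℕ' m))
      (+-monoˡ-≤ (fromℕ' m) (-≤⇒≤+ (subst (x - y ≤_) (ι-neg m) x-y≤-m)))

  +fromℕ'-trans : ∀ {x y z} m m' → x + fromℕ' m ≤ y → y + fromℕ' m' ≤ z → x + fromℕ' (m' +ℕ m) ≤ z
  +fromℕ'-trans {x} {y} {z} m m' x+m≤y y+m'≤z = begin
    x + fromℕ' (m' +ℕ m)          ≡⟨ cong (λ w → x + w) (fromℕ'-+ m m') ⟩
    x + (fromℕ' m + fromℕ' m')    ≡⟨ +-assoc x (fromℕ' m) (fromℕ' m') ⟨
    (x + fromℕ' m) + fromℕ' m'    ≤⟨ +-monoˡ-≤ (fromℕ' m') x+m≤y ⟩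
    y + fromℕ' m'                 ≤⟨ y+m'≤z ⟩
    z                             ∎
    where open ≤-Reasoning

module Dynamics (G : OrderedGroup) {n : ℕ}
                (σ : Strategies.Strategy G n) (dynamic : Strategies.Dynamic G σ) where
  open OrderedGroup G
  open Strategies G
  open OrderedGroupProperties G

  AgreeBefore : Carrier → Scenario n → Scenario n → Set
  AgreeBefore t s s' = ∀ p → σ s (O p) < t → s p ≡ s' p

  -- Well-founded induction over the execution times of all tasks in s and in s' (the Bool
  -- picks the scenario); the order is well-founded because there are finitely many tasks.
  agreement : ∀ {t s s'} → AgreeBefore t s s' → ∀ T → σ s T < t ⊎ σ s' T < t → σ s' T ≡ σ s T
  agreement {t} {s} {s'} agree T = [ settled (true , T) , settled (false , T) ]′
    where
    time : Bool × Task n → Carrier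
    time (true , T)  = σ s T
    time (false , T) = σ s' T

    Settled : Bool × Task n → Set
    Settled (b , T) = time (b , T) < t → σ s' T ≡ σ s T

    step : ∀ q → (∀ {q'} → time q' < time q → Settled q') → Settled q
    step (true , T) ih T<t = dynamic s s' T λ p →
        ( (λ lt → subst (_< σ s T) (sym (ih {true , O p} lt (<-trans lt T<t))) lt)
        , (λ lt → subst (_< σ s T) (ih {false , O p} lt (<-trans lt T<t)) lt) )
      , λ lt → agree p (<-trans lt T<t)
    step (false , T) ih T<t = sym (dynamic s' s T λ p →
        ( (λ lt → subst (_< σ s' T) (ih {false , O p} lt (<-trans lt T<t)) lt)
        , (λ lt → subst (_< σ s' T) (sym (ih {true , O p} lt (<-trans lt T<t))) lt) )
      , λ lt → sym (agree p (subst (_< t) (ih {false , O p} lt (<-trans lt T<t)) (<-trans lt T<t))))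

    settled : ∀ q → Settled q
    settled = All.wfRec wf _ Settled step
      where
      wf : WellFounded (λ q q' → time q < time q')
      wf = finite-spo-wellFounded (cartesianProduct (true ∷ false ∷ []) (allTasks n))
             (λ (b , T) → ∈-cartesianProduct⁺ (bool-complete b) (allTasks-complete T))
             (λ { refl → <-irrefl refl }) <-trans

  history-determines : ∀ {s s' T} → AgreeBefore (σ s T) s s' → σ s' T ≡ σ s T
  history-determines {s} {s'} {T} agree = dynamic s s' T λ p →
      ( (λ lt → subst (_< σ s T) (sym (agreement agree (O p) (inj₁ lt))) lt)
      , (λ lt → subst (_< σ s T) (agreement agree (O p) (inj₂ lt)) lt) )
    , agree p

module Gadget (G : OrderedGroup) {n : ℕ} (φ : CNF n) (σ : Strategies.Strategy G n)
              (viable : Strategies.Viable G φ σ) (dynamic : Strategies.Dynamic G σ) (i : Fin n) where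
  open OrderedGroup G
  open Strategies G
  open OrderedGroupProperties G
  open Dynamics G σ dynamic
  open ≤-Reasoning

  Aᵢ Bᵢ Aᵢ₊₁ Bᵢ₊₁ : Task n
  Aᵢ   = A (inject₁ i)
  Bᵢ   = B (inject₁ i)
  Aᵢ₊₁ = A (suc i)
  Bᵢ₊₁ = B (suc i)

  C : Bool → Task n
  C false = C0 i
  C true  = C1 i

  holds : ∀ {c} s → c ∈ perIndex n i → s ⊨ Constraint.label c →
          σ s (Constraint.to c) - σ s (Constraint.from c) ≤ ι (Constraint.δ c)
  holds s c∈ = viable s _ (perIndex⊆constraints φ i c∈)

  D-by-B : ∀ s → s ⊨ ((pc0 i , true) ∷ (pc1 i , true) ∷ []) → σ s (D i) ≤ σ s Bᵢ + 1#
  D-by-B s ⊨c = subst (λ w → σ s (D i) ≤ σ s Bᵢ + w) fromℕ'-1 (-≤⇒≤+ (holds s (here refl) ⊨c))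

  D-after-A : ∀ s → s ⊨ ((pc0 i , false) ∷ (pc1 i , false) ∷ []) →
              σ s Aᵢ + fromℕ' (n +ℕ 2) ≤ σ s (D i)
  D-after-A s ⊨c = -≤ι-neg⇒+≤ (n +ℕ 2) (holds s (there (here refl)) ⊨c)

  X-after-A : ∀ s → σ s Aᵢ + fromℕ' (n +ℕ 2) ≤ σ s (X i)
  X-after-A s = -≤ι-neg⇒+≤ (n +ℕ 2) (holds s (there (there (here refl))) [])

  next-A-after-A : ∀ s → σ s Aᵢ + fromℕ' (n +ℕ 4) ≤ σ s Aᵢ₊₁
  next-A-after-A s =
    subst (λ m → σ s Aᵢ + fromℕ' m ≤ σ s Aᵢ₊₁) (sym n+4≡2+[n+2])
      (+fromℕ'-trans (1 +ℕ (n +ℕ 2)) 1 (+fromℕ'-trans (n +ℕ 2) 1 (X-after-A s) Y-after-X) A-after-Y)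
    where
    Y-after-X : σ s (X i) + fromℕ' 1 ≤ σ s (Y i)
    Y-after-X = -≤ι-neg⇒+≤ 1 (holds s (there (there (there (here refl)))) [])
    A-after-Y : σ s (Y i) + fromℕ' 1 ≤ σ s Aᵢ₊₁
    A-after-Y = -≤ι-neg⇒+≤ 1 (holds s (there (there (there (there (here refl))))) [])
    n+4≡2+[n+2] : n +ℕ 4 ≡ 2 +ℕ (n +ℕ 2)
    n+4≡2+[n+2] = trans (ℕ.+-suc n 3) (cong suc (ℕ.+-suc n 2))

  next-B-by-C : ∀ v s → s (px i) ≡ v → σ s Bᵢ₊₁ ≤ σ s (C v) + fromℕ' (n +ℕ 4)
  next-B-by-C false s x≡v =
    -≤⇒≤+ (holds s (there (there (there (there (there (here refl)))))) (x≡v ∷ []))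
  next-B-by-C true s x≡v =
    -≤⇒≤+ (holds s (there (there (there (there (there (there (here refl))))))) (x≡v ∷ []))

  x<x+fromℕ'[n+2] : ∀ x → x < x + fromℕ' (n +ℕ 2)
  x<x+fromℕ'[n+2] x = x<x+fromℕ' x (ℕ.<-≤-trans (s≤s z≤n) (ℕ.m≤n+m 2 n))

  A-before-X : ∀ s → σ s Aᵢ < σ s (X i)
  A-before-X s = <-≤-trans (x<x+fromℕ'[n+2] (σ s Aᵢ)) (X-after-A s)

  set-c : Bool → Scenario n → Scenario n
  set-c v s = (s [ v / pc0 i ]) [ v / pc1 i ]

  set-c-⊨ : ∀ v s → set-c v s ⊨ ((pc0 i , v) ∷ (pc1 i , v) ∷ [])
  set-c-⊨ v s = trans (update-≢ (s [ v / pc0 i ]) v {pc0 i} {pc1 i} (λ ())) (update-same s v (pc0 i))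
             ∷ update-same (s [ v / pc0 i ]) v (pc1 i) ∷ []

  set-c-≢ : ∀ v s {p} → p ≢ pc0 i → p ≢ pc1 i → set-c v s p ≡ s p
  set-c-≢ v s p≢c0 p≢c1 = trans (update-≢ (s [ v / pc0 i ]) v p≢c1) (update-≢ s v p≢c0)

  some-c-early : ∀ s → σ s Bᵢ + 1# < σ s Aᵢ + fromℕ' (n +ℕ 2) →
                 ¬ (σ s Bᵢ + 1# ≤ σ s (C0 i) × σ s Bᵢ + 1# ≤ σ s (C1 i))
  some-c-early s early (c0-late , c1-late) = <⇒≱ early A+n+2≤t
    where
    t = σ s Bᵢ + 1#
    s¹ = set-c true s
    s⁰ = set-c false s

    agree : ∀ v → AgreeBefore t s (set-c v s)
    agree v p p<t = sym (set-c-≢ v s (λ { refl → <⇒≱ p<t c0-late }) (λ { refl → <⇒≱ p<t c1-late }))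

    D¹≤t : σ s¹ (D i) ≤ t
    D¹≤t = subst (λ b → σ s¹ (D i) ≤ b + 1#) (agreement (agree true) Bᵢ (inj₁ (x<x+1 _)))
             (D-by-B s¹ (set-c-⊨ true s))

    agree¹⁰ : AgreeBefore (σ s¹ (D i)) s¹ s⁰
    agree¹⁰ p p<D = trans (sym (agree true p p<t)) (agree false p p<t)
      where
      p¹<t = <-≤-trans p<D D¹≤t
      p<t : σ s (O p) < t
      p<t = subst (_< t) (agreement (agree true) (O p) (inj₂ p¹<t)) p¹<t

    A⁰+n+2≤t : σ s⁰ Aᵢ + fromℕ' (n +ℕ 2) ≤ t
    A⁰+n+2≤t = ≤-trans (D-after-A s⁰ (set-c-⊨ false s))
                       (subst (_≤ t) (sym (history-determines agree¹⁰)) D¹≤t)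

    A⁰≡A : σ s⁰ Aᵢ ≡ σ s Aᵢ
    A⁰≡A = agreement (agree false) Aᵢ (inj₂ (<-≤-trans (x<x+fromℕ'[n+2] _) A⁰+n+2≤t))

    A+n+2≤t : σ s Aᵢ + fromℕ' (n +ℕ 2) ≤ t
    A+n+2≤t = subst (λ a → a + fromℕ' (n +ℕ 2) ≤ t) A⁰≡A A⁰+n+2≤t

  next-gap-bound : ∀ s v m → m <ℕ n +ℕ 2 → σ s (C v) ≤ σ s Aᵢ + fromℕ' m →
                   σ (s [ v / px i ]) Bᵢ₊₁ - σ (s [ v / px i ]) Aᵢ₊₁ ≤ fromℕ' m
  next-gap-bound s v m m<n+2 C≤A+m = ≤+⇒-≤ (begin
    σ s' Bᵢ₊₁                                   ≤⟨ next-B-by-C v s' (update-same s v (px i)) ⟩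
    σ s' (C v) + fromℕ' (n +ℕ 4)                ≡⟨ cong (λ c → c + fromℕ' (n +ℕ 4)) C'≡C ⟩
    σ s (C v) + fromℕ' (n +ℕ 4)                 ≤⟨ +-monoˡ-≤ (fromℕ' (n +ℕ 4)) C≤A+m ⟩
    (σ s Aᵢ + fromℕ' m) + fromℕ' (n +ℕ 4)       ≡⟨ +-swapʳ (σ s Aᵢ) (fromℕ' m) (fromℕ' (n +ℕ 4)) ⟩
    (σ s Aᵢ + fromℕ' (n +ℕ 4)) + fromℕ' m       ≡⟨ cong (λ a → (a + fromℕ' (n +ℕ 4)) + fromℕ' m) A'≡A ⟨
    (σ s' Aᵢ + fromℕ' (n +ℕ 4)) + fromℕ' m      ≤⟨ +-monoˡ-≤ (fromℕ' m) (next-A-after-A s') ⟩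
    σ s' Aᵢ₊₁ + fromℕ' m                        ∎)
    where
    s' = s [ v / px i ]

    agree : AgreeBefore (σ s (X i)) s s'
    agree p p<X = sym (update-≢ s v {q = px i} λ { refl → <-irrefl refl p<X })

    C<X : σ s (C v) < σ s (X i)
    C<X = begin-strict
      σ s (C v)                    ≤⟨ C≤A+m ⟩
      σ s Aᵢ + fromℕ' m            <⟨ +-monoʳ-< (σ s Aᵢ) (fromℕ'-strictMono m<n+2) ⟩
      σ s Aᵢ + fromℕ' (n +ℕ 2)     ≤⟨ X-after-A s ⟩
      σ s (X i)                    ∎

    A'≡A : σ s' Aᵢ ≡ σ s Aᵢ
    A'≡A = agreement agree Aᵢ (inj₁ (A-before-X s))

    C'≡C : σ s' (C v) ≡ σ s (C v)
    C'≡C = agreement agree (C v) (inj₁ C<X)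

lemma20 : (G : OrderedGroup) → let open OrderedGroup G in let open Strategies G in
    (n : ℕ) (φ : CNF n) (σ : Strategy n) → Viable φ σ → Dynamic σ →
    (s : Scenario n) (i : Fin n) →
    σ s (B (inject₁ i)) - σ s (A (inject₁ i)) ≤ ι (+ toℕ i) →
      (σ s (C0 i) < σ s (B (inject₁ i)) + 1# →
         σ (s [ false / px i ]) (B (suc i)) - σ (s [ false / px i ]) (A (suc i)) ≤ ι (+ suc (toℕ i)))
    × (¬ (σ s (C0 i) < σ s (B (inject₁ i)) + 1#) →
         σ (s [ true / px i ]) (B (suc i)) - σ (s [ true / px i ]) (A (suc i)) ≤ ι (+ suc (toℕ i)))
lemma20 G n φ σ viable dynamic s i B-A≤i =
    (λ c0-early → next-gap-bound s false _ i+1<n+2 (≤-trans (proj₁ c0-early) B+1≤A+i+1))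
  , (λ c0-not-early → next-gap-bound s true _ i+1<n+2 (≤-trans (c1-early c0-not-early) B+1≤A+i+1))
  where
  open OrderedGroup G
  open OrderedGroupProperties G
  open Gadget G φ σ viable dynamic i

  -- toℕ i is the paper's i - 1.
  B+1≤A+i+1 : σ s Bᵢ + 1# ≤ σ s Aᵢ + fromℕ' (suc (toℕ i))
  B+1≤A+i+1 =
    subst (σ s Bᵢ + 1# ≤_) (+-assoc (σ s Aᵢ) (fromℕ' (toℕ i)) 1#) (+-monoˡ-≤ 1# (-≤⇒≤+ B-A≤i))

  i+1<n+2 : suc (toℕ i) <ℕ n +ℕ 2
  i+1<n+2 = ℕ.≤-<-trans (toℕ<n i) (ℕ.m<m+n n (s≤s z≤n))

  B+1<A+n+2 : σ s Bᵢ + 1# < σ s Aᵢ + fromℕ' (n +ℕ 2)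
  B+1<A+n+2 = ≤-<-trans B+1≤A+i+1 (+-monoʳ-< (σ s Aᵢ) (fromℕ'-strictMono i+1<n+2))

  c1-early : ¬ (σ s (C0 i) < σ s Bᵢ + 1#) → σ s (C1 i) ≤ σ s Bᵢ + 1#
  c1-early c0-not-early = ≰⇒≥ λ c1-late → c0-not-early (≰⇒> λ c0-late →
    some-c-early s B+1<A+n+2 (c0-late , c1-late))
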